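{- Let $G_1,G_2$ be vertex-disjoint finite simple connected graphs, $G_i$ having $n_i$ vertices and $m_i$ edges, and let $G_1+G_2$ be their join (the union $G_1\cup G_2$ together with all edges joining a vertex of $G_1$ to a vertex of $G_2$). Then \[F(G_1+G_2)=F(G_1)+F(G_2)+3n_2M_1(G_1)+3n_1M_1(G_2)+6n_2^2m_1+6n_1^2m_2+n_1n_2^3+n_2n_1^3.\]
   Context: For a finite simple graph $G$ with vertex degrees $d_G(v)$: $M_1(G)=\sum_{v\in V(G)} d_G(v)^2$ (first Zagreb index) and $F(G)=\sum_{v\in V(G)} d_G(v)^3$ (F-index). -}

module Defs where

open import Data.Nat using (ℕ; zero; suc; _+_; _*_; _^_; _<ᵇ_)
open import Data.Bool using (Bool; true; false; _∧_; if_then_else_)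
open import Data.Fin using (Fin; toℕ; splitAt)
open import Data.Sum using (_⊎_; inj₁; inj₂)
open import Data.List using (List; map; allFin)
open import Data.Nat.ListAction using (sum)
open import Relation.Binary.PropositionalEquality using (_≡_)

record Graph (n : ℕ) : Set where
  field
    adj    : Fin n → Fin n → Bool
    sym    : ∀ i j → adj i j ≡ adj j i
    irrefl : ∀ i → adj i i ≡ false
open Graph public

countB : {n : ℕ} → (Fin n → Bool) → ℕ
countB {n} p = sum (map (λ i → if p i then 1 else 0) (allFin n))

deg : {n : ℕ} → Graph n → Fin n → ℕ
deg G v = countB (adj G v)

edgeCount : {n : ℕ} → Graph n → ℕ
edgeCount {n} G =
  sum (map (λ i → countB (λ j → (toℕ i <ᵇ toℕ j) ∧ adj G i j)) (allFin n))

M₁ : {n : ℕ} → Graph n → ℕ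
M₁ {n} G = sum (map (λ v → deg G v ^ 2) (allFin n))

Findex : {n : ℕ} → Graph n → ℕ
Findex {n} G = sum (map (λ v → deg G v ^ 3) (allFin n))

data Walk {n : ℕ} (G : Graph n) : Fin n → Fin n → Set where
  here : ∀ {u} → Walk G u u
  step : ∀ {u v w} → adj G u v ≡ true → Walk G v w → Walk G u w

Connected : {n : ℕ} → Graph n → Set
Connected {n} G = ∀ (u v : Fin n) → Walk G u v

-- join G1 + G2 on vertex set Fin (n1 + n2): the first n1 vertices are
-- those of G1, the last n2 those of G2 (disjoint union), and every vertex
-- of G1 is joined to every vertex of G2.
joinAdj : {n₁ n₂ : ℕ} → Graph n₁ → Graph n₂ →
          Fin n₁ ⊎ Fin n₂ → Fin n₁ ⊎ Fin n₂ → Bool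
joinAdj G₁ G₂ (inj₁ i) (inj₁ j) = adj G₁ i j
joinAdj G₁ G₂ (inj₂ i) (inj₂ j) = adj G₂ i j
joinAdj G₁ G₂ (inj₁ i) (inj₂ j) = true
joinAdj G₁ G₂ (inj₂ i) (inj₁ j) = true

joinAdj-sym : {n₁ n₂ : ℕ} (G₁ : Graph n₁) (G₂ : Graph n₂) →
              ∀ x y → joinAdj G₁ G₂ x y ≡ joinAdj G₁ G₂ y x
joinAdj-sym G₁ G₂ (inj₁ i) (inj₁ j) = sym G₁ i j
joinAdj-sym G₁ G₂ (inj₂ i) (inj₂ j) = sym G₂ i j
joinAdj-sym G₁ G₂ (inj₁ i) (inj₂ j) = Relation.Binary.PropositionalEquality.refl
joinAdj-sym G₁ G₂ (inj₂ i) (inj₁ j) = Relation.Binary.PropositionalEquality.refl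

joinAdj-irrefl : {n₁ n₂ : ℕ} (G₁ : Graph n₁) (G₂ : Graph n₂) →
                 ∀ x → joinAdj G₁ G₂ x x ≡ false
joinAdj-irrefl G₁ G₂ (inj₁ i) = irrefl G₁ i
joinAdj-irrefl G₁ G₂ (inj₂ i) = irrefl G₂ i

join : {n₁ n₂ : ℕ} → Graph n₁ → Graph n₂ → Graph (n₁ + n₂)
join {n₁} G₁ G₂ = record
  { adj    = λ i j → joinAdj G₁ G₂ (splitAt n₁ i) (splitAt n₁ j)
  ; sym    = λ i j → joinAdj-sym G₁ G₂ (splitAt n₁ i) (splitAt n₁ j)
  ; irrefl = λ i → joinAdj-irrefl G₁ G₂ (splitAt n₁ i)
  }

module Submission where

-- In G₁ + G₂ a vertex of G₁ keeps its G₁-neighbours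
-- and gains all n₂ vertices of G₂, so its degree is d + n₂; symmetrically a
-- vertex of G₂ has degree d + n₁.  Expanding (d + c)³ by the binomial theorem
-- and summing over the vertices of Gᵢ gives
--   Σ (d + c)³ = Σ d³ + 3c Σ d² + 3c² Σ d + |V| c³ ,
-- where Σ d³ = F, Σ d² = M₁ and, by the handshake lemma, Σ d = 2m.

open import Defs hiding (sym)
open import Defs using () renaming (sym to adj-sym)
open import Data.Nat using (ℕ; zero; suc; _+_; _*_; _^_; _<ᵇ_; _<_)
open import Data.Nat.Properties
  using (+-*-semiring; +-assoc; +-comm; +-identityʳ; *-identityʳ; <⇒<ᵇ; <ᵇ⇒<; <-cmp; <-irrefl)
open import Data.Nat.Tactic.RingSolver using (solve-∀)
open import Data.Bool using (Bool; true; false; _∧_; if_then_else_)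
open import Data.Bool.Properties using (T-≡)
open import Data.Fin using (Fin; zero; suc; toℕ; splitAt; _↑ˡ_; _↑ʳ_)
open import Data.Fin.Properties using (splitAt-↑ˡ; splitAt-↑ʳ; toℕ-injective)
open import Data.Sum using (inj₁; inj₂)
open import Data.List using (map; allFin; tabulate)
open import Data.List.Properties using (map-tabulate)
import Data.Nat.ListAction as List
open import Data.Vec.Functional using (Vector)
open import Function using (_∘_; Equivalence)
open import Relation.Nullary using (¬_)
open import Data.Empty using (⊥-elim)
open import Relation.Binary using (tri<; tri≈; tri>)
open import Relation.Binary.PropositionalEquality
open import Algebra.Properties.Semiring.Sum +-*-semiring
  using (sum; sum-syntax; sum-cong-≗; ∑-distrib-+; ∑-comm; *-distribˡ-sum)
open ≡-Reasoning

listSum-allFin : {n : ℕ} (f : Fin n → ℕ) → List.sum (map f (allFin n)) ≡ sum f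
listSum-allFin {zero}  f = refl
listSum-allFin {suc n} f = cong (f zero +_) (begin
  List.sum (map f (tabulate suc))         ≡⟨ cong List.sum (map-tabulate suc f) ⟩
  List.sum (tabulate (f ∘ suc))           ≡⟨ cong List.sum (map-tabulate (λ i → i) (f ∘ suc)) ⟨
  List.sum (map (f ∘ suc) (allFin n))     ≡⟨ listSum-allFin (f ∘ suc) ⟩
  sum (f ∘ suc)                           ∎)

∑-const : (n c : ℕ) → ∑[ i < n ] c ≡ n * c
∑-const zero    c = refl
∑-const (suc n) c = cong (c +_) (∑-const n c)

∑-split : (n₁ n₂ : ℕ) (f : Fin (n₁ + n₂) → ℕ) →
          sum f ≡ ∑[ i < n₁ ] f (i ↑ˡ n₂) + ∑[ j < n₂ ] f (n₁ ↑ʳ j)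
∑-split zero     n₂ f = refl
∑-split (suc n₁) n₂ f = trans (cong (f zero +_) (∑-split n₁ n₂ (f ∘ suc))) (sym (+-assoc (f zero) _ _))

ind : Bool → ℕ
ind b = if b then 1 else 0

countB-∑ : {n : ℕ} (p : Fin n → Bool) → countB p ≡ ∑[ i < n ] ind (p i)
countB-∑ p = listSum-allFin (ind ∘ p)

count-all : (n : ℕ) → ∑[ i < n ] ind true ≡ n
count-all n = trans (∑-const n 1) (*-identityʳ n)

<ᵇ-true : ∀ {m n} → m < n → (m <ᵇ n) ≡ true
<ᵇ-true m<n = Equivalence.to T-≡ (<⇒<ᵇ m<n)

<ᵇ-false : ∀ {m n} → ¬ (m < n) → (m <ᵇ n) ≡ false
<ᵇ-false {m} {n} m≮n with m <ᵇ n in eq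
... | false = refl
... | true  = ⊥-elim (m≮n (<ᵇ⇒< m n (Equivalence.from T-≡ eq)))

forward : {n : ℕ} → Graph n → Fin n → Fin n → Bool
forward G i j = (toℕ i <ᵇ toℕ j) ∧ adj G i j

forwardEdge : {n : ℕ} → Graph n → Fin n → Fin n → ℕ
forwardEdge G i j = ind (forward G i j)

-- Every ordered adjacent pair is a forward edge read in exactly one
-- direction: symmetry handles i > j, irreflexivity the diagonal i = j.
adj-forward : {n : ℕ} (G : Graph n) (i j : Fin n) →
              ind (adj G i j) ≡ forwardEdge G i j + forwardEdge G j i
adj-forward G i j with <-cmp (toℕ i) (toℕ j)
... | tri< i<j _ j≮i rewrite <ᵇ-true i<j | <ᵇ-false j≮i with adj G i j
...   | true  = refl
...   | false = refl
adj-forward G i j | tri> i≮j _ j<i rewrite <ᵇ-true j<i | <ᵇ-false i≮j | adj-sym G j i with adj G i j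
...   | true  = refl
...   | false = refl
adj-forward G i j | tri≈ _ i≡j _ rewrite toℕ-injective i≡j | irrefl G j | <ᵇ-false (<-irrefl (refl {x = toℕ j})) = refl

edgeCount-∑ : {n : ℕ} (G : Graph n) → edgeCount G ≡ ∑[ i < n ] ∑[ j < n ] forwardEdge G i j
edgeCount-∑ G = trans (listSum-allFin (λ i → countB (forward G i)))
                      (sum-cong-≗ (λ i → countB-∑ (forward G i)))

handshake : {n : ℕ} (G : Graph n) → sum (deg G) ≡ 2 * edgeCount G
handshake {n} G = begin
  sum (deg G)                                                 ≡⟨ sum-cong-≗ (λ i → countB-∑ (adj G i)) ⟩
  ∑[ i < n ] ∑[ j < n ] ind (adj G i j)                       ≡⟨ sum-cong-≗ (λ i → sum-cong-≗ (adj-forward G i)) ⟩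
  ∑[ i < n ] ∑[ j < n ] (A i j + A j i)                       ≡⟨ sum-cong-≗ (λ i → ∑-distrib-+ (A i) (λ j → A j i)) ⟩
  ∑[ i < n ] (∑[ j < n ] A i j + ∑[ j < n ] A j i)            ≡⟨ ∑-distrib-+ (λ i → ∑[ j < n ] A i j) (λ i → ∑[ j < n ] A j i) ⟩
  ∑[ i < n ] ∑[ j < n ] A i j + ∑[ i < n ] ∑[ j < n ] A j i   ≡⟨ cong (E +_) (∑-comm (λ i j → A j i)) ⟩
  E + E                                                       ≡⟨ cong (E +_) (+-identityʳ E) ⟨
  2 * E                                                       ≡⟨ cong (2 *_) (edgeCount-∑ G) ⟨
  2 * edgeCount G                                             ∎
  where
  A : Fin n → Fin n → ℕ
  A = forwardEdge G
  E : ℕ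
  E = ∑[ i < n ] ∑[ j < n ] A i j

module _ {n₁ n₂ : ℕ} (G₁ : Graph n₁) (G₂ : Graph n₂) where

  private
    adjJ : Fin (n₁ + n₂) → Fin (n₁ + n₂) → Bool
    adjJ = adj (join G₁ G₂)

  deg-join : (v : Fin (n₁ + n₂)) →
    deg (join G₁ G₂) v ≡ ∑[ i < n₁ ] ind (joinAdj G₁ G₂ (splitAt n₁ v) (inj₁ i))
                       + ∑[ j < n₂ ] ind (joinAdj G₁ G₂ (splitAt n₁ v) (inj₂ j))
  deg-join v = begin
    deg (join G₁ G₂) v                                        ≡⟨ countB-∑ (adjJ v) ⟩
    sum (ind ∘ adjJ v)                                        ≡⟨ ∑-split n₁ n₂ (ind ∘ adjJ v) ⟩
    ∑[ i < n₁ ] ind (adjJ v (i ↑ˡ n₂)) + ∑[ j < n₂ ] ind (adjJ v (n₁ ↑ʳ j))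
      ≡⟨ cong₂ _+_ (sum-cong-≗ (λ i → cong (ind ∘ joinAdj G₁ G₂ (splitAt n₁ v)) (splitAt-↑ˡ n₁ i n₂)))
                   (sum-cong-≗ (λ j → cong (ind ∘ joinAdj G₁ G₂ (splitAt n₁ v)) (splitAt-↑ʳ n₁ n₂ j))) ⟩
    ∑[ i < n₁ ] ind (joinAdj G₁ G₂ (splitAt n₁ v) (inj₁ i))
      + ∑[ j < n₂ ] ind (joinAdj G₁ G₂ (splitAt n₁ v) (inj₂ j)) ∎

  deg-join-left : (i : Fin n₁) → deg (join G₁ G₂) (i ↑ˡ n₂) ≡ deg G₁ i + n₂
  deg-join-left i rewrite deg-join (i ↑ˡ n₂) | splitAt-↑ˡ n₁ i n₂ =
    cong₂ _+_ (sym (countB-∑ (adj G₁ i))) (count-all n₂)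

  deg-join-right : (j : Fin n₂) → deg (join G₁ G₂) (n₁ ↑ʳ j) ≡ deg G₂ j + n₁
  deg-join-right j rewrite deg-join (n₁ ↑ʳ j) | splitAt-↑ʳ n₁ n₂ j =
    trans (cong₂ _+_ (count-all n₁) (sym (countB-∑ (adj G₂ j)))) (+-comm n₁ (deg G₂ j))

cube-shift : ∀ d c → (d + c) ^ 3 ≡ d ^ 3 + 3 * c * d ^ 2 + 3 * c ^ 2 * d + c ^ 3
cube-shift = expand
  where
  -- the same identity with the powers unfolded, as the ring solver expects
  expand : ∀ d c → (d + c) * ((d + c) * ((d + c) * 1))
           ≡ d * (d * (d * 1)) + 3 * c * (d * (d * 1)) + 3 * (c * (c * 1)) * d + c * (c * (c * 1))
  expand = solve-∀

cube-shift-∑ : {k : ℕ} (d : Vector ℕ k) (c : ℕ) →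
  ∑[ i < k ] ((d i + c) ^ 3) ≡
  ∑[ i < k ] (d i ^ 3) + 3 * c * ∑[ i < k ] (d i ^ 2) + 3 * c ^ 2 * sum d + k * c ^ 3
cube-shift-∑ {k} d c = begin
  ∑[ i < k ] ((d i + c) ^ 3)
    ≡⟨ sum-cong-≗ (λ i → cube-shift (d i) c) ⟩
  ∑[ i < k ] (d i ^ 3 + 3 * c * d i ^ 2 + 3 * c ^ 2 * d i + c ^ 3)
    ≡⟨ ∑-distrib-+ (λ i → d i ^ 3 + 3 * c * d i ^ 2 + 3 * c ^ 2 * d i) (λ _ → c ^ 3) ⟩
  ∑[ i < k ] (d i ^ 3 + 3 * c * d i ^ 2 + 3 * c ^ 2 * d i) + ∑[ i < k ] (c ^ 3)
    ≡⟨ cong₂ _+_ (∑-distrib-+ (λ i → d i ^ 3 + 3 * c * d i ^ 2) (λ i → 3 * c ^ 2 * d i)) (∑-const k (c ^ 3)) ⟩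
  ∑[ i < k ] (d i ^ 3 + 3 * c * d i ^ 2) + ∑[ i < k ] (3 * c ^ 2 * d i) + k * c ^ 3
    ≡⟨ cong₂ (λ a b → a + b + k * c ^ 3) (∑-distrib-+ (λ i → d i ^ 3) (λ i → 3 * c * d i ^ 2))
                                         (sym (*-distribˡ-sum (3 * c ^ 2) d)) ⟩
  ∑[ i < k ] (d i ^ 3) + ∑[ i < k ] (3 * c * d i ^ 2) + 3 * c ^ 2 * sum d + k * c ^ 3
    ≡⟨ cong (λ a → ∑[ i < k ] (d i ^ 3) + a + 3 * c ^ 2 * sum d + k * c ^ 3)
            (sym (*-distribˡ-sum (3 * c) (λ i → d i ^ 2))) ⟩
  ∑[ i < k ] (d i ^ 3) + 3 * c * ∑[ i < k ] (d i ^ 2) + 3 * c ^ 2 * sum d + k * c ^ 3 ∎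

F-shift : {k : ℕ} (G : Graph k) (c : ℕ) →
  ∑[ i < k ] ((deg G i + c) ^ 3) ≡ Findex G + 3 * c * M₁ G + 6 * c ^ 2 * edgeCount G + k * c ^ 3
F-shift {k} G c = begin
  ∑[ i < k ] ((deg G i + c) ^ 3)
    ≡⟨ cube-shift-∑ (deg G) c ⟩
  ∑[ i < k ] (deg G i ^ 3) + 3 * c * ∑[ i < k ] (deg G i ^ 2) + 3 * c ^ 2 * sum (deg G) + k * c ^ 3
    ≡⟨ cong₂ (λ f s → f + 3 * c * s + 3 * c ^ 2 * sum (deg G) + k * c ^ 3)
             (sym (listSum-allFin (λ v → deg G v ^ 3))) (sym (listSum-allFin (λ v → deg G v ^ 2))) ⟩
  Findex G + 3 * c * M₁ G + 3 * c ^ 2 * sum (deg G) + k * c ^ 3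
    ≡⟨ cong (λ s → Findex G + 3 * c * M₁ G + 3 * c ^ 2 * s + k * c ^ 3) (handshake G) ⟩
  Findex G + 3 * c * M₁ G + 3 * c ^ 2 * (2 * edgeCount G) + k * c ^ 3
    ≡⟨ cong (λ s → Findex G + 3 * c * M₁ G + s + k * c ^ 3) (twice c (edgeCount G)) ⟩
  Findex G + 3 * c * M₁ G + 6 * c ^ 2 * edgeCount G + k * c ^ 3 ∎
  where
  -- powers unfolded for the ring solver
  twice : ∀ c m → 3 * (c * (c * 1)) * (2 * m) ≡ 6 * (c * (c * 1)) * m
  twice = solve-∀

corollary2 : {n₁ n₂ : ℕ} (G₁ : Graph n₁) (G₂ : Graph n₂) →
    Connected G₁ → Connected G₂ →
    Findex (join G₁ G₂) ≡
      Findex G₁ + Findex G₂ + 3 * n₂ * M₁ G₁ + 3 * n₁ * M₁ G₂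
      + 6 * n₂ ^ 2 * edgeCount G₁ + 6 * n₁ ^ 2 * edgeCount G₂
      + n₁ * n₂ ^ 3 + n₂ * n₁ ^ 3
corollary2 {n₁} {n₂} G₁ G₂ _ _ = begin
  Findex (join G₁ G₂)
    ≡⟨ listSum-allFin (λ v → deg (join G₁ G₂) v ^ 3) ⟩
  ∑[ v < n₁ + n₂ ] (deg (join G₁ G₂) v ^ 3)
    ≡⟨ ∑-split n₁ n₂ (λ v → deg (join G₁ G₂) v ^ 3) ⟩
  ∑[ i < n₁ ] (deg (join G₁ G₂) (i ↑ˡ n₂) ^ 3) + ∑[ j < n₂ ] (deg (join G₁ G₂) (n₁ ↑ʳ j) ^ 3)
    ≡⟨ cong₂ _+_ (sum-cong-≗ (λ i → cong (_^ 3) (deg-join-left G₁ G₂ i)))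
                 (sum-cong-≗ (λ j → cong (_^ 3) (deg-join-right G₁ G₂ j))) ⟩
  ∑[ i < n₁ ] ((deg G₁ i + n₂) ^ 3) + ∑[ j < n₂ ] ((deg G₂ j + n₁) ^ 3)
    ≡⟨ cong₂ _+_ (F-shift G₁ n₂) (F-shift G₂ n₁) ⟩
  (Findex G₁ + 3 * n₂ * M₁ G₁ + 6 * n₂ ^ 2 * edgeCount G₁ + n₁ * n₂ ^ 3)
    + (Findex G₂ + 3 * n₁ * M₁ G₂ + 6 * n₁ ^ 2 * edgeCount G₂ + n₂ * n₁ ^ 3)
    ≡⟨ regroup (Findex G₁) (Findex G₂) (3 * n₂ * M₁ G₁) (3 * n₁ * M₁ G₂)
               (6 * n₂ ^ 2 * edgeCount G₁) (6 * n₁ ^ 2 * edgeCount G₂) (n₁ * n₂ ^ 3) (n₂ * n₁ ^ 3) ⟩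
  Findex G₁ + Findex G₂ + 3 * n₂ * M₁ G₁ + 3 * n₁ * M₁ G₂
    + 6 * n₂ ^ 2 * edgeCount G₁ + 6 * n₁ ^ 2 * edgeCount G₂
    + n₁ * n₂ ^ 3 + n₂ * n₁ ^ 3 ∎
  where
  regroup : ∀ f₁ f₂ z₁ z₂ e₁ e₂ c₁ c₂ →
    (f₁ + z₁ + e₁ + c₁) + (f₂ + z₂ + e₂ + c₂) ≡ f₁ + f₂ + z₁ + z₂ + e₁ + e₂ + c₁ + c₂
  regroup = solve-∀
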